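{- Let $X$ be a finite set. Every maximal generalized single-crossing domain $\mathcal{D}\subseteq\mathcal{R}(X)$ is connected, i.e., its associated graph $\Gamma_{\mathcal{D}}$ is a subgraph of the permutohedron.
   Context: $\mathcal{R}(X)$ is the set of strict linear orders on $X$. For $R,R'\in\mathcal{R}(X)$ let $[R,R']=\{Q\in\mathcal{R}(X): Q\supseteq R\cap R'\}$. $\Gamma_{\mathcal{D}}$ is the graph on $\mathcal{D}$ with distinct $R,R'$ adjacent iff $[R,R']\cap\mathcal{D}=\{R,R'\}$. $\mathcal{D}$ is single-crossing with respect to a tree $T=(V,E)$ if $|\mathcal{D}|=|V|$ and $\mathcal{D}=\{R_v: v\in V\}$ (bijectively) with $R_u\in[R_v,R_{v'}]$ whenever $u$ lies on the $T$-path between $v$ and $v'$; $\mathcal{D}$ is generalized single-crossing if it is single-crossing with respect to some tree, and a maximal generalized single-crossing domain if no generalized single-crossing domain on $X$ properly contains it. The permutohedron is the graph on $\mathcal{R}(X)$ in which two orders are adjacent iff one is obtained from the other by swapping two alternatives that are adjacent in it. -}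

module Defs where

open import Level using (Level; 0ℓ) renaming (suc to lsuc)
open import Data.Nat using (ℕ; NonZero)
open import Data.Fin using (Fin)
open import Data.Bool using (Bool; true; false)
open import Data.Vec using (Vec; lookup)
open import Data.List using (List; []; _∷_)
open import Data.List.Membership.Propositional using (_∈_)
open import Data.List.Relation.Unary.Unique.Propositional using (Unique)
open import Data.Product using (Σ; ∃; ∃-syntax; _×_; _,_)
open import Data.Sum using (_⊎_)
open import Relation.Nullary using (¬_)
open import Relation.Binary.PropositionalEquality using (_≡_; _≢_)
open import Function.Definitions using (Injective)
open import Function.Bundles using (_⇔_)

-- Binary relations on the finite set X = Fin n, stored as Boolean
-- adjacency matrices (so that equality of relations is ≡).

BRel : ℕ → Set
BRel n = Vec (Vec Bool n) n

_∶_≻_ : ∀ {n} → BRel n → Fin n → Fin n → Set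
R ∶ a ≻ b = lookup (lookup R a) b ≡ true

record IsStrictLinearOrder {n : ℕ} (R : BRel n) : Set where
  field
    irrefl : ∀ a → ¬ (R ∶ a ≻ a)
    trans  : ∀ a b c → R ∶ a ≻ b → R ∶ b ≻ c → R ∶ a ≻ c
    total  : ∀ a b → a ≢ b → (R ∶ a ≻ b) ⊎ (R ∶ b ≻ a)

-- membership in ℛ(X) is IsStrictLinearOrder; a domain is a subset of ℛ(X)
Domain : ℕ → Set₁
Domain n = BRel n → Set

IsDomain : ∀ {n} → Domain n → Set
IsDomain {n} 𝒟 = ∀ (R : BRel n) → 𝒟 R → IsStrictLinearOrder R

_⊆_ : ∀ {n} → Domain n → Domain n → Set
_⊆_ {n} 𝒟 𝒟' = ∀ (R : BRel n) → 𝒟 R → 𝒟' R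

_∈[_,_] : ∀ {n} → BRel n → BRel n → BRel n → Set
Q ∈[ R , R' ] = IsStrictLinearOrder Q ×
  (∀ a b → R ∶ a ≻ b → R' ∶ a ≻ b → Q ∶ a ≻ b)

data Walk {m : ℕ} (E : Fin m → Fin m → Set) : Fin m → Fin m → List (Fin m) → Set where
  here : ∀ v → Walk E v v (v ∷ [])
  step : ∀ {u v w vs} → E u v → Walk E v w vs → Walk E u w (u ∷ vs)

Path : ∀ {m} → (Fin m → Fin m → Set) → Fin m → Fin m → List (Fin m) → Set
Path E v w vs = Walk E v w vs × Unique vs

record IsTree (m : ℕ) (E : Fin m → Fin m → Set) : Set where
  field
    nonempty  : NonZero m
    symmetric : ∀ u v → E u v → E v u
    loopless  : ∀ v → ¬ E v v
    connected : ∀ u v → ∃[ vs ] Path E u v vs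
    uniquePath : ∀ u v vs ws → Path E u v vs → Path E u v ws → vs ≡ ws

SingleCrossingWrt : ∀ {n} → Domain n → (m : ℕ) → (Fin m → Fin m → Set) → Set
SingleCrossingWrt {n} 𝒟 m E =
  Σ (Fin m → BRel n) λ f →
    Injective _≡_ _≡_ f ×
    (∀ R → 𝒟 R ⇔ (∃[ v ] f v ≡ R)) ×
    (∀ v v' u vs → Path E v v' vs → u ∈ vs → f u ∈[ f v , f v' ])

GeneralizedSingleCrossing : ∀ {n} → Domain n → Set₁
GeneralizedSingleCrossing 𝒟 =
  IsDomain 𝒟 ×
  Σ ℕ λ m → Σ (Fin m → Fin m → Set) λ E → IsTree m E × SingleCrossingWrt 𝒟 m E

MaximalGSC : ∀ {n} → Domain n → Set₁
MaximalGSC {n} 𝒟 =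
  GeneralizedSingleCrossing 𝒟 ×
  (∀ (𝒟' : Domain n) → GeneralizedSingleCrossing 𝒟' →
     ¬ (𝒟 ⊆ 𝒟' × ∃[ R ] (𝒟' R × ¬ 𝒟 R)))

ΓAdj : ∀ {n} → Domain n → BRel n → BRel n → Set
ΓAdj 𝒟 R R' =
  𝒟 R × 𝒟 R' × R ≢ R' ×
  (∀ Q → 𝒟 Q → Q ∈[ R , R' ] → (Q ≡ R) ⊎ (Q ≡ R'))

SwapAdjacent : ∀ {n} → BRel n → Fin n → Fin n → BRel n → Set
SwapAdjacent R a b R' =
  R ∶ a ≻ b ×
  (∀ c → ¬ (R ∶ a ≻ c × R ∶ c ≻ b)) ×
  R' ∶ b ≻ a × ¬ (R' ∶ a ≻ b) ×
  (∀ x y → ¬ (x ≡ a × y ≡ b) → ¬ (x ≡ b × y ≡ a) →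
     lookup (lookup R' x) y ≡ lookup (lookup R x) y)

PermAdj : ∀ {n} → BRel n → BRel n → Set
PermAdj R R' =
  IsStrictLinearOrder R × IsStrictLinearOrder R' ×
  ∃[ a ] ∃[ b ] (SwapAdjacent R a b R' ⊎ SwapAdjacent R' a b R)

module Submission where

-- Let f label the vertices of a tree T by the orders of 𝒟.  Since R , R' are
-- Γ-adjacent, no third label lies between them, so v and w are adjacent in T.
-- As R ≠ R', some pair a , b is adjacent in R (a just above b) but inverted
-- in R'; swapping it in R gives a linear order Q with R ∩ R' ⊆ Q ⊆ R ∪ R'.
-- If Q = R' we are done.  Otherwise Q ∉ 𝒟 (a label f t = Q would put t beyond
-- v or beyond w, and either case forces Q = R'), and subdividing the edge
-- v — w by a new vertex labelled Q makes 𝒟 ∪ {Q} generalized single-crossing,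
-- contradicting maximality.

open import Defs
open import Data.Nat using (ℕ; zero; suc; _≤_; _<_; _+_)
import Data.Nat.Properties as ℕ
open import Data.Fin using (Fin; zero; suc)
open import Data.Fin.Properties using (_≟_; suc-injective)
import Data.Fin.Properties as Fin
open import Data.Fin.Subset as Subset using (∣_∣)
open import Data.Fin.Subset.Properties using (p⊂q⇒∣p∣<∣q∣)
open import Data.Fin.Permutation.Components using (transpose; transpose-inverse)
open import Data.Bool using (Bool; true; false)
import Data.Bool as Bool
open import Data.Vec using (Vec; lookup; tabulate)
open import Data.Vec.Properties using (lookup∘tabulate; tabulate∘lookup; tabulate-cong; []=⇒lookup; lookup⇒[]=; ≡-dec)
open import Data.List using (List; []; _∷_; _∷ʳ_; reverse)
open import Data.List.Properties using (∷-injective; reverse-injective; unfold-reverse)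
open import Data.List.Membership.Propositional using (_∈_; _∉_)
open import Data.List.Membership.Propositional.Properties using (∈-++⁺ˡ)
open import Data.List.Relation.Unary.Any using (here; there; any?)
import Data.List.Relation.Unary.Any.Properties as Any
open import Data.List.Relation.Unary.All using ([])
open import Data.List.Relation.Unary.All.Properties using (¬Any⇒All¬)
open import Data.List.Relation.Unary.AllPairs using ([]; _∷_)
open import Data.List.Relation.Unary.Unique.Propositional using (Unique)
import Data.List.Relation.Unary.Unique.Propositional.Properties as UniqueProp
open UniqueProp using (Unique[x∷xs]⇒x∉xs)
open import Data.List.Relation.Binary.Subset.Propositional using () renaming (_⊆_ to _⊆ₗ_)
open import Data.List.Relation.Binary.Permutation.Propositional using (↭-sym; ↭⇒↭ₛ)
open import Data.List.Relation.Binary.Permutation.Propositional.Properties using (↭-reverse)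
import Data.List.Relation.Binary.Permutation.Setoid.Properties as PermutationSetoid
open import Data.Product using (∃-syntax; _×_; _,_; proj₁; proj₂) renaming (map to ×-map)
open import Data.Sum using (_⊎_; inj₁; inj₂) renaming (map to ⊎-map)
open import Data.Empty using (⊥; ⊥-elim)
open import Relation.Nullary using (¬_; Dec; yes; no; contradiction)
open import Relation.Nullary.Decidable using (_×-dec_; _⊎-dec_; dec-true; dec-false)
open import Relation.Binary.PropositionalEquality
open import Function using (_∘_)
open import Function.Bundles using (_⇔_; mk⇔; Equivalence)
open import Function.Definitions using (Injective)

entry : ∀ {n} → BRel n → Fin n → Fin n → Bool
entry R x y = lookup (lookup R x) y

Vec-ext : ∀ {A : Set} {k} {u v : Vec A k} → (∀ i → lookup u i ≡ lookup v i) → u ≡ v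
Vec-ext {u = u} {v} h = trans (sym (tabulate∘lookup u)) (trans (tabulate-cong h) (tabulate∘lookup v))

BRel-ext : ∀ {n} {R S : BRel n} → (∀ x y → entry R x y ≡ entry S x y) → R ≡ S
BRel-ext h = Vec-ext (λ x → Vec-ext (h x))

Bool-ext : ∀ {p q : Bool} → (p ≡ true → q ≡ true) → (q ≡ true → p ≡ true) → p ≡ q
Bool-ext {true}  {true}  _ _ = refl
Bool-ext {true}  {false} f _ = sym (f refl)
Bool-ext {false} {true}  _ g = g refl
Bool-ext {false} {false} _ _ = refl

_∶_≻?_ : ∀ {n} (R : BRel n) a b → Dec (R ∶ a ≻ b)
R ∶ a ≻? b = entry R a b Bool.≟ true

module LinearOrder {n} {R : BRel n} (L : IsStrictLinearOrder R) where
  open IsStrictLinearOrder L public renaming (trans to ≻-trans)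

  asym : ∀ {a b} → R ∶ a ≻ b → ¬ R ∶ b ≻ a
  asym {a} {b} p q = irrefl a (≻-trans a b a p q)

  ≻⇒≢ : ∀ {a b} → R ∶ a ≻ b → a ≢ b
  ≻⇒≢ {a} p refl = irrefl a p

  connex : ∀ {a b} → a ≢ b → ¬ R ∶ a ≻ b → R ∶ b ≻ a
  connex {a} {b} a≢b a⊁b with total a b a≢b
  ... | inj₁ a≻b = contradiction a≻b a⊁b
  ... | inj₂ b≻a = b≻a

linear-⊆⇒≡ : ∀ {n} {Q S : BRel n} → IsStrictLinearOrder Q → IsStrictLinearOrder S →
  (∀ x y → Q ∶ x ≻ y → S ∶ x ≻ y) → Q ≡ S
linear-⊆⇒≡ {Q = Q} {S} LQ LS Q⊆S = BRel-ext λ x y → Bool-ext (Q⊆S x y) (S⇒Q x y)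
  where
  open LinearOrder
  S⇒Q : ∀ x y → S ∶ x ≻ y → Q ∶ x ≻ y
  S⇒Q x y S-xy with Q ∶ x ≻? y
  ... | yes Q-xy = Q-xy
  ... | no Q⊁xy = contradiction (Q⊆S y x (connex LQ (≻⇒≢ LS S-xy) Q⊁xy)) (asym LS S-xy)

relabel : ∀ {n} → (Fin n → Fin n) → BRel n → BRel n
relabel σ R = tabulate λ x → tabulate λ y → entry R (σ x) (σ y)

relabel-entry : ∀ {n} (σ : Fin n → Fin n) (R : BRel n) x y →
  entry (relabel σ R) x y ≡ entry R (σ x) (σ y)
relabel-entry σ R x y =
  trans (cong (λ row → lookup row y) (lookup∘tabulate _ x)) (lookup∘tabulate _ y)

relabel-linear : ∀ {n} (σ : Fin n → Fin n) {R : BRel n} → Injective _≡_ _≡_ σ →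
  IsStrictLinearOrder R → IsStrictLinearOrder (relabel σ R)
relabel-linear σ {R} σ-inj L = record
  { irrefl = λ x p → irrefl (σ x) (to-R x x p)
  ; trans  = λ x y z p q → from-R x z (≻-trans (σ x) (σ y) (σ z) (to-R x y p) (to-R y z q))
  ; total  = λ x y x≢y → ⊎-map (from-R x y) (from-R y x) (total (σ x) (σ y) (λ eq → x≢y (σ-inj eq)))
  }
  where
  open LinearOrder L
  to-R : ∀ x y → relabel σ R ∶ x ≻ y → R ∶ σ x ≻ σ y
  to-R x y p = trans (sym (relabel-entry σ R x y)) p
  from-R : ∀ x y → R ∶ σ x ≻ σ y → relabel σ R ∶ x ≻ y
  from-R x y p = trans (relabel-entry σ R x y) p

-- Since nothing lies between them, a and b relate
-- in the same way to every other alternative; hence relabelling R along the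
-- transposition (a b) yields a linear order Q that differs from R exactly at
-- the pair {a , b}.
module AdjacentSwap {n} {R : BRel n} (L : IsStrictLinearOrder R) {a b : Fin n}
  (a≻b : R ∶ a ≻ b) (nothing-between : ∀ c → ¬ (R ∶ a ≻ c × R ∶ c ≻ b)) where
  open LinearOrder L

  τ : Fin n → Fin n
  τ = transpose a b

  τ-injective : Injective _≡_ _≡_ τ
  τ-injective eq =
    trans (sym (transpose-inverse b a)) (trans (cong (transpose b a) eq) (transpose-inverse b a))

  τ-a : τ a ≡ b
  τ-a rewrite dec-true (a ≟ a) refl = refl

  τ-b : τ b ≡ a
  τ-b rewrite dec-false (b ≟ a) (≻⇒≢ a≻b ∘ sym) | dec-true (b ≟ b) refl = refl

  τ-fix : ∀ {c} → a ≢ c → b ≢ c → τ c ≡ c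
  τ-fix {c} a≢c b≢c rewrite dec-false (c ≟ a) (a≢c ∘ sym) | dec-false (c ≟ b) (b≢c ∘ sym) = refl

  twin-row : ∀ {c} → a ≢ c → b ≢ c → entry R a c ≡ entry R b c
  twin-row {c} a≢c b≢c = Bool-ext
    (λ a≻c → connex (b≢c ∘ sym) (λ c≻b → nothing-between c (a≻c , c≻b)))
    (λ b≻c → ≻-trans a b c a≻b b≻c)

  twin-col : ∀ {c} → a ≢ c → b ≢ c → entry R c a ≡ entry R c b
  twin-col {c} a≢c b≢c = Bool-ext
    (λ c≻a → ≻-trans c a b c≻a a≻b)
    (λ c≻b → connex a≢c (λ a≻c → nothing-between c (a≻c , c≻b)))

  τ-row : ∀ x {y} → a ≢ y → b ≢ y → entry R (τ x) y ≡ entry R x y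
  τ-row x a≢y b≢y with a ≟ x | b ≟ x
  ... | yes refl | _ = trans (cong (λ z → entry R z _) τ-a) (sym (twin-row a≢y b≢y))
  ... | no _ | yes refl = trans (cong (λ z → entry R z _) τ-b) (twin-row a≢y b≢y)
  ... | no a≢x | no b≢x = cong (λ z → entry R z _) (τ-fix a≢x b≢x)

  τ-col : ∀ {x} y → a ≢ x → b ≢ x → entry R x (τ y) ≡ entry R x y
  τ-col y a≢x b≢x with a ≟ y | b ≟ y
  ... | yes refl | _ = trans (cong (entry R _) τ-a) (sym (twin-col a≢x b≢x))
  ... | no _ | yes refl = trans (cong (entry R _) τ-b) (twin-col a≢x b≢x)
  ... | no a≢y | no b≢y = cong (entry R _) (τ-fix a≢y b≢y)

  diagonal : ∀ z → entry R z z ≡ false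
  diagonal z with entry R z z in eq
  ... | true = contradiction eq (irrefl z)
  ... | false = refl

  Q : BRel n
  Q = relabel τ R

  Q-linear : IsStrictLinearOrder Q
  Q-linear = relabel-linear τ τ-injective L

  Q-b≻a : Q ∶ b ≻ a
  Q-b≻a = trans (relabel-entry τ R b a) (trans (cong₂ (entry R) τ-b τ-a) a≻b)

  Q-a⊁b : ¬ Q ∶ a ≻ b
  Q-a⊁b = LinearOrder.asym Q-linear Q-b≻a

  Q-agrees : ∀ x y → ¬ (x ≡ a × y ≡ b) → ¬ (x ≡ b × y ≡ a) → entry Q x y ≡ entry R x y
  Q-agrees x y not-ab not-ba = trans (relabel-entry τ R x y) (agrees x y not-ab not-ba)
    where
    agrees : ∀ x y → ¬ (x ≡ a × y ≡ b) → ¬ (x ≡ b × y ≡ a) → entry R (τ x) (τ y) ≡ entry R x y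
    agrees x y not-ab not-ba with x ≟ y | a ≟ y | b ≟ y | a ≟ x | b ≟ x
    ... | yes refl | _ | _ | _ | _ = trans (diagonal (τ x)) (sym (diagonal x))
    ... | no _ | no a≢y | no b≢y | _ | _ =
      trans (cong (entry R (τ x)) (τ-fix a≢y b≢y)) (τ-row x a≢y b≢y)
    ... | no _ | _ | _ | no a≢x | no b≢x =
      trans (cong (λ z → entry R z (τ y)) (τ-fix a≢x b≢x)) (τ-col y a≢x b≢x)
    ... | no x≢y | yes refl | _ | yes refl | _ = contradiction refl x≢y
    ... | no _ | yes refl | _ | _ | yes refl = contradiction (refl , refl) not-ba
    ... | no _ | _ | yes refl | yes refl | _ = contradiction (refl , refl) not-ab
    ... | no x≢y | _ | yes refl | _ | yes refl = contradiction refl x≢y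

  Q-⊆ : ∀ x y → Q ∶ x ≻ y → (x ≡ b × y ≡ a) ⊎ R ∶ x ≻ y
  Q-⊆ x y Q-xy with x ≟ a ×-dec y ≟ b | x ≟ b ×-dec y ≟ a
  ... | yes (refl , refl) | _ = contradiction Q-xy Q-a⊁b
  ... | no _ | yes ba = inj₁ ba
  ... | no not-ab | no not-ba = inj₂ (trans (sym (Q-agrees x y not-ab not-ba)) Q-xy)

  Q-⊇ : ∀ x y → R ∶ x ≻ y → ¬ (x ≡ a × y ≡ b) → Q ∶ x ≻ y
  Q-⊇ x y R-xy not-ab with x ≟ b ×-dec y ≟ a
  ... | yes (refl , refl) = Q-b≻a
  ... | no not-ba = trans (Q-agrees x y not-ab not-ba) R-xy

  swap-adjacent : SwapAdjacent R a b Q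
  swap-adjacent = a≻b , nothing-between , Q-b≻a , Q-a⊁b , Q-agrees

record AdjacentInversion {n} (R R' : BRel n) : Set where
  field
    top bottom      : Fin n
    top≻bottom      : R ∶ top ≻ bottom
    nothing-between : ∀ c → ¬ (R ∶ top ≻ c × R ∶ c ≻ bottom)
    inverted        : R' ∶ bottom ≻ top

-- Any inversion
-- (a , b) is shrunk to an adjacent one: a c strictly between a and b forms
-- an inversion with a or with b, and is strictly closer in rank.
module Inversions {n} {R R' : BRel n} (L : IsStrictLinearOrder R) (L' : IsStrictLinearOrder R') where
  open LinearOrder

  rank : Fin n → ℕ
  rank a = ∣ lookup R a ∣

  rank-mono : ∀ {a b} → R ∶ a ≻ b → rank b < rank a
  rank-mono {a} {b} a≻b = p⊂q⇒∣p∣<∣q∣ (below-b⊆below-a , b , lookup⇒[]= b _ a≻b , b∉below-b)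
    where
    below-b⊆below-a : lookup R b Subset.⊆ lookup R a
    below-b⊆below-a {x} x∈ = lookup⇒[]= x _ (≻-trans L a b x a≻b ([]=⇒lookup x∈))
    b∉below-b : ¬ b Subset.∈ lookup R b
    b∉below-b b∈ = irrefl L b ([]=⇒lookup b∈)

  shrink : ∀ k a b → rank a ≤ k + rank b → R ∶ a ≻ b → R' ∶ b ≻ a → AdjacentInversion R R'
  shrink zero a b gap a≻b b≻'a = contradiction gap (ℕ.<⇒≱ (rank-mono a≻b))
  shrink (suc k) a b gap a≻b b≻'a with Fin.any? (λ c → (R ∶ a ≻? c) ×-dec (R ∶ c ≻? b))
  ... | no none = record { top≻bottom = a≻b ; nothing-between = λ c between → none (c , between) ; inverted = b≻'a }
  ... | yes (c , a≻c , c≻b) with R' ∶ c ≻? a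
  ...   | yes c≻'a = shrink k a c gap′ a≻c c≻'a
    where
    gap′ : rank a ≤ k + rank c
    gap′ = ℕ.≤-trans gap (ℕ.≤-trans (ℕ.≤-reflexive (sym (ℕ.+-suc k (rank b)))) (ℕ.+-monoʳ-≤ k (rank-mono c≻b)))
  ...   | no c⊁'a = shrink k c b gap′ c≻b (≻-trans L' b a c b≻'a (connex L' (≻⇒≢ L a≻c ∘ sym) c⊁'a))
    where
    gap′ : rank c ≤ k + rank b
    gap′ = ℕ.≤-pred (ℕ.≤-trans (rank-mono a≻c) gap)

  adjacent-inversion : R ≢ R' → AdjacentInversion R R'
  adjacent-inversion R≢R' with Fin.any? (λ x → Fin.any? (λ y → (R ∶ x ≻? y) ×-dec (R' ∶ y ≻? x)))
  ... | yes (x , y , x≻y , y≻'x) = shrink (rank x) x y (ℕ.m≤m+n (rank x) (rank y)) x≻y y≻'x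
  ... | no none = contradiction (linear-⊆⇒≡ L L' R⊆R') R≢R'
    where
    R⊆R' : ∀ x y → R ∶ x ≻ y → R' ∶ x ≻ y
    R⊆R' x y x≻y with R' ∶ x ≻? y
    ... | yes x≻'y = x≻'y
    ... | no x⊁'y = contradiction (x , y , x≻y , connex L' (≻⇒≢ L x≻y) x⊁'y) none

module _ {A : Set} where
  unique-∷ : ∀ {x : A} {xs} → x ∉ xs → Unique xs → Unique (x ∷ xs)
  unique-∷ {xs = xs} x∉xs u = ¬Any⇒All¬ xs x∉xs ∷ u

  unique-reverse : ∀ {xs : List A} → Unique xs → Unique (reverse xs)
  unique-reverse {xs} = PermutationSetoid.Unique-resp-↭ (setoid A) (↭⇒↭ₛ (↭-sym (↭-reverse xs)))

module Walks {m : ℕ} (E : Fin m → Fin m → Set) where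

  start∈ : ∀ {a b vs} → Walk E a b vs → a ∈ vs
  start∈ (here _) = here refl
  start∈ (step _ _) = here refl

  end∈ : ∀ {a b vs} → Walk E a b vs → b ∈ vs
  end∈ (here _) = here refl
  end∈ (step _ w) = there (end∈ w)

  snoc : ∀ {a b c vs} → Walk E a b vs → E b c → Walk E a c (vs ∷ʳ c)
  snoc (here _) e = step e (here _)
  snoc (step e′ w) e = step e′ (snoc w e)

  extend-path : ∀ {a b c vs} → Path E a b vs → E b c → c ∉ vs → Path E a c (vs ∷ʳ c)
  extend-path (p , u) e c∉vs = snoc p e , UniqueProp.++⁺ u ([] ∷ []) λ { (c∈vs , here refl) → c∉vs c∈vs }

  reverse-walk : (∀ u v → E u v → E v u) → ∀ {a b vs} → Walk E a b vs → Walk E b a (reverse vs)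
  reverse-walk E-sym (here v) = here v
  reverse-walk E-sym (step {u} {v} {vs = vs} e w) =
    subst (Walk E _ _) (sym (unfold-reverse u vs)) (snoc (reverse-walk E-sym w) (E-sym u v e))

  reverse-path : (∀ u v → E u v → E v u) → ∀ {a b vs} → Path E a b vs → Path E b a (reverse vs)
  reverse-path E-sym (w , u) = reverse-walk E-sym w , unique-reverse u

  subpath : ∀ {a b c vs} → Path E a b vs → c ∈ vs → ∃[ ws ] (Path E c b ws × ws ⊆ₗ vs)
  subpath p@(here _ , _) (here refl) = _ , p , λ x∈ → x∈
  subpath p@(step _ _ , _) (here refl) = _ , p , λ x∈ → x∈
  subpath (step _ w , _ ∷ u) (there c∈) with subpath (w , u) c∈
  ... | ws , p , ws⊆ = ws , p , λ x∈ → there (ws⊆ x∈)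

  walk⇒path : ∀ {a b vs} → Walk E a b vs → ∃[ ws ] Path E a b ws
  walk⇒path (here v) = _ , here v , [] ∷ []
  walk⇒path {a} (step e w) with walk⇒path w
  ... | ws , p with any? (a ≟_) ws
  ...   | yes a∈ws = let (ws′ , p′ , _) = subpath p a∈ws in ws′ , p′
  ...   | no a∉ws = _ , step e (proj₁ p) , unique-∷ a∉ws (proj₂ p)

-- Subdividing the edge v — w of a tree by a new vertex yields a tree.  In
-- Fin (suc m) the vertex zero is the new midpoint and suc x is the old x.
module Subdivision {m : ℕ} {E : Fin m → Fin m → Set} (T : IsTree m E) {v w : Fin m} (v—w : E v w) where
  open IsTree T
  open Walks

  v≢w : v ≢ w
  v≢w refl = loopless v v—w

  Endpoint : Fin m → Set
  Endpoint x = x ≡ v ⊎ x ≡ w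

  Ends : Fin m → Fin m → Set
  Ends x y = (x ≡ v × y ≡ w) ⊎ (x ≡ w × y ≡ v)

  Eˢ : Fin (suc m) → Fin (suc m) → Set
  Eˢ zero    zero    = ⊥
  Eˢ zero    (suc y) = Endpoint y
  Eˢ (suc x) zero    = Endpoint x
  Eˢ (suc x) (suc y) = E x y × ¬ Ends x y

  ends? : ∀ x y → Dec (Ends x y)
  ends? x y = (x ≟ v ×-dec y ≟ w) ⊎-dec (x ≟ w ×-dec y ≟ v)

  ends-sym : ∀ {x y} → Ends x y → Ends y x
  ends-sym (inj₁ (x≡v , y≡w)) = inj₂ (y≡w , x≡v)
  ends-sym (inj₂ (x≡w , y≡v)) = inj₁ (y≡v , x≡w)

  ends-edge : ∀ {x y} → Ends x y → E x y
  ends-edge (inj₁ (refl , refl)) = v—w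
  ends-edge (inj₂ (refl , refl)) = symmetric v w v—w

  ends-endpoint : ∀ {x y} → Ends x y → Endpoint x
  ends-endpoint (inj₁ (x≡v , _)) = inj₁ x≡v
  ends-endpoint (inj₂ (x≡w , _)) = inj₂ x≡w

  ends-≢ : ∀ {x y} → Ends x y → x ≢ y
  ends-≢ (inj₁ (refl , refl)) = v≢w
  ends-≢ (inj₂ (refl , refl)) = v≢w ∘ sym

  partner : ∀ {x} → Endpoint x → ∃[ y ] Ends x y
  partner (inj₁ x≡v) = w , inj₁ (x≡v , refl)
  partner (inj₂ x≡w) = v , inj₂ (x≡w , refl)

  distinct-endpoints : ∀ {x y} → Endpoint x → Endpoint y → x ≢ y → Ends x y
  distinct-endpoints (inj₁ refl) (inj₁ refl) x≢y = contradiction refl x≢y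
  distinct-endpoints (inj₁ refl) (inj₂ refl) _   = inj₁ (refl , refl)
  distinct-endpoints (inj₂ refl) (inj₁ refl) _   = inj₂ (refl , refl)
  distinct-endpoints (inj₂ refl) (inj₂ refl) x≢y = contradiction refl x≢y

  both-ends : ∀ {P : Fin m → Set} {x y} → Ends x y → P x → P y → P v × P w
  both-ends (inj₁ (refl , refl)) Px Py = Px , Py
  both-ends (inj₂ (refl , refl)) Px Py = Py , Px

  Eˢ-sym : ∀ a b → Eˢ a b → Eˢ b a
  Eˢ-sym zero    (suc y) e = e
  Eˢ-sym (suc x) zero    e = e
  Eˢ-sym (suc x) (suc y) (e , ¬ends) = symmetric x y e , ¬ends ∘ ends-sym

  Eˢ-loopless : ∀ a → ¬ Eˢ a a
  Eˢ-loopless zero ()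
  Eˢ-loopless (suc x) (e , _) = loopless x e

  trace : List (Fin (suc m)) → List (Fin m)
  trace []          = []
  trace (zero ∷ l)  = trace l
  trace (suc x ∷ l) = x ∷ trace l

  ∈-trace⁺ : ∀ {u l} → suc u ∈ l → u ∈ trace l
  ∈-trace⁺ {l = zero  ∷ l} (there u∈) = ∈-trace⁺ u∈
  ∈-trace⁺ {l = suc x ∷ l} (here refl) = here refl
  ∈-trace⁺ {l = suc x ∷ l} (there u∈) = there (∈-trace⁺ u∈)

  ∈-trace⁻ : ∀ {u l} → u ∈ trace l → suc u ∈ l
  ∈-trace⁻ {l = zero  ∷ l} u∈ = there (∈-trace⁻ u∈)
  ∈-trace⁻ {l = suc x ∷ l} (here refl) = here refl
  ∈-trace⁻ {l = suc x ∷ l} (there u∈) = there (∈-trace⁻ u∈)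

  unique-trace : ∀ {l} → Unique l → Unique (trace l)
  unique-trace {[]} _ = []
  unique-trace {zero  ∷ l} (_ ∷ u) = unique-trace u
  unique-trace {suc x ∷ l} u@(_ ∷ u′) = unique-∷ (Unique[x∷xs]⇒x∉xs u ∘ ∈-trace⁻) (unique-trace u′)

  trace-head : ∀ {z b vs} → Walk Eˢ (suc z) b vs → ∃[ l ] trace vs ≡ z ∷ l
  trace-head (here _)   = _ , refl
  trace-head (step _ _) = _ , refl

  same-next : ∀ {z₁ z₂ b₁ b₂ vs₁ vs₂} → Walk Eˢ (suc z₁) b₁ vs₁ → Walk Eˢ (suc z₂) b₂ vs₂ →
    trace vs₁ ≡ trace vs₂ → z₁ ≡ z₂
  same-next r₁ r₂ eq with trace-head r₁ | trace-head r₂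
  ... | _ , t₁ | _ , t₂ = proj₁ (∷-injective (trans (sym t₁) (trans eq t₂)))

  detour-ends : ∀ {x z b vs} → Eˢ (suc x) zero → Eˢ zero (suc z) → Walk Eˢ (suc z) b vs →
    Unique (suc x ∷ zero ∷ vs) → Ends x z
  detour-ends x-end z-end r u = distinct-endpoints x-end z-end
    λ { refl → Unique[x∷xs]⇒x∉xs u (there (start∈ Eˢ r)) }

  trace-walk : ∀ {x y qs} → Walk Eˢ (suc x) (suc y) qs → Unique qs → Walk E x y (trace qs)
  trace-walk (here _) _ = here _
  trace-walk (step {v = suc z} (e , _) r) (_ ∷ u) = step e (trace-walk r u)
  trace-walk (step {v = zero} x-end (step {v = suc z} z-end r)) u@(_ ∷ _ ∷ u′) =
    step (ends-edge (detour-ends x-end z-end r u)) (trace-walk r u′)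

  trace-path : ∀ {x y qs} → Path Eˢ (suc x) (suc y) qs → Path E x y (trace qs)
  trace-path (p , u) = trace-walk p u , unique-trace u

  -- a path between old vertices is determined by its trace: the next old
  -- vertex is read off the trace, and the midpoint is visited in between
  -- exactly when the two are the ends of the subdivided edge
  trace-injective : ∀ {x y qs rs} → Walk Eˢ (suc x) (suc y) qs → Walk Eˢ (suc x) (suc y) rs →
    Unique qs → Unique rs → trace qs ≡ trace rs → qs ≡ rs
  trace-injective (here _) (here _) _ _ _ = refl
  trace-injective (here _) (step _ r) _ u _ = contradiction (end∈ Eˢ r) (Unique[x∷xs]⇒x∉xs u)
  trace-injective (step _ r) (here _) u _ _ = contradiction (end∈ Eˢ r) (Unique[x∷xs]⇒x∉xs u)
  trace-injective (step {v = suc z₁} _ r₁) (step {v = suc z₂} _ r₂) (_ ∷ u₁) (_ ∷ u₂) eq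
    with same-next r₁ r₂ (proj₂ (∷-injective eq))
  ... | refl = cong (_ ∷_) (trace-injective r₁ r₂ u₁ u₂ (proj₂ (∷-injective eq)))
  trace-injective (step {v = suc z₁} (_ , ¬ends) r₁) (step {v = zero} x-end (step {v = suc _} z-end r₂)) _ u₂ eq
    with same-next r₁ r₂ (proj₂ (∷-injective eq))
  ... | refl = contradiction (detour-ends x-end z-end r₂ u₂) ¬ends
  trace-injective (step {v = zero} x-end (step {v = suc _} z-end r₁)) (step {v = suc z₂} (_ , ¬ends) r₂) u₁ _ eq
    with same-next r₁ r₂ (proj₂ (∷-injective eq))
  ... | refl = contradiction (detour-ends x-end z-end r₁ u₁) ¬ends
  trace-injective (step {v = zero} _ (step {v = suc z₁} _ r₁)) (step {v = zero} _ (step {v = suc z₂} _ r₂))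
    (_ ∷ _ ∷ u₁) (_ ∷ _ ∷ u₂) eq
    with same-next r₁ r₂ (proj₂ (∷-injective eq))
  ... | refl = cong (λ l → _ ∷ zero ∷ l) (trace-injective r₁ r₂ u₁ u₂ (proj₂ (∷-injective eq)))

  -- Paths are unique in the subdivided graph; between old vertices this
  -- follows from uniqueness in the old tree via the trace.
  unique-old-old : ∀ {x y qs rs} → Path Eˢ (suc x) (suc y) qs → Path Eˢ (suc x) (suc y) rs → qs ≡ rs
  unique-old-old {x} {y} p q =
    trace-injective (proj₁ p) (proj₁ q) (proj₂ p) (proj₂ q) (uniquePath x y _ _ (trace-path p) (trace-path q))

  -- a path from one end of the edge that avoids the midpoint never visits
  -- the other end: otherwise going through the midpoint instead would give a
  -- second path with the same ends
  avoids-partner : ∀ {z z̄ y qs} → Ends z z̄ → Path Eˢ (suc z) (suc y) qs → zero ∉ qs → suc z̄ ∉ qs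
  avoids-partner ends (here _ , _) _ (here eq) = ends-≢ ends (suc-injective (sym eq))
  avoids-partner ends (step _ _ , _) _ (here eq) = ends-≢ ends (suc-injective (sym eq))
  avoids-partner {z} ends (step e r , u@(_ ∷ u′)) zero∉ (there z̄∈) with subpath Eˢ (r , u′) z̄∈
  ... | s , p , s⊆ = zero∉ (subst (zero ∈_) (sym (unique-old-old (step e r , u) detour)) (there (here refl)))
    where
    detour : Path Eˢ (suc z) _ (suc z ∷ zero ∷ s)
    detour = step (ends-endpoint ends) (step (ends-endpoint (ends-sym ends)) (proj₁ p)) ,
             unique-∷ (λ { (there z∈) → Unique[x∷xs]⇒x∉xs u (s⊆ z∈) })
                      (unique-∷ (zero∉ ∘ there ∘ s⊆) (proj₂ p))

  -- two paths from the midpoint leaving towards different ends would give,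
  -- after prepending the other end, two paths with the same ends
  unique-mid-old : ∀ {y qs rs} → Path Eˢ zero (suc y) qs → Path Eˢ zero (suc y) rs → qs ≡ rs
  unique-mid-old (step {v = suc z₁} e₁ r₁ , u₁@(_ ∷ u₁′)) (step {v = suc z₂} e₂ r₂ , u₂@(_ ∷ u₂′)) with z₁ ≟ z₂
  ... | yes refl = cong (zero ∷_) (unique-old-old (r₁ , u₁′) (r₂ , u₂′))
  ... | no z₁≢z₂ = contradiction (subst (zero ∈_) (unique-old-old detour (r₂ , u₂′)) (there (here refl)))
                                 (Unique[x∷xs]⇒x∉xs u₂)
    where
    ends : Ends z₂ z₁
    ends = distinct-endpoints e₂ e₁ (z₁≢z₂ ∘ sym)
    detour : Path Eˢ (suc z₂) _ (suc z₂ ∷ zero ∷ _)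
    detour = step (ends-endpoint ends) (step e₁ r₁) ,
             unique-∷ (λ { (there z₂∈) → avoids-partner (ends-sym ends) (r₁ , u₁′) (Unique[x∷xs]⇒x∉xs u₁) z₂∈ }) u₁

  unique-old-mid : ∀ {x qs rs} → Path Eˢ (suc x) zero qs → Path Eˢ (suc x) zero rs → qs ≡ rs
  unique-old-mid p q = reverse-injective (unique-mid-old (reverse-path Eˢ Eˢ-sym p) (reverse-path Eˢ Eˢ-sym q))

  mid-loop : ∀ {qs} → Path Eˢ zero zero qs → qs ≡ zero ∷ []
  mid-loop (here _ , _) = refl
  mid-loop (step _ r , u) = contradiction (end∈ Eˢ r) (Unique[x∷xs]⇒x∉xs u)

  Eˢ-unique : ∀ a b qs rs → Path Eˢ a b qs → Path Eˢ a b rs → qs ≡ rs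
  Eˢ-unique zero    zero    _ _ p q = trans (mid-loop p) (sym (mid-loop q))
  Eˢ-unique zero    (suc y) _ _ p q = unique-mid-old p q
  Eˢ-unique (suc x) zero    _ _ p q = unique-old-mid p q
  Eˢ-unique (suc x) (suc y) _ _ p q = unique-old-old p q

  lift : ∀ {x y ps} → Walk E x y ps → ∃[ qs ] Walk Eˢ (suc x) (suc y) qs
  lift (here x) = _ , here (suc x)
  lift (step {u = x} {v = z} e r) with ends? x z
  ... | yes ends = _ , step {v = zero} (ends-endpoint ends) (step (ends-endpoint (ends-sym ends)) (proj₂ (lift r)))
  ... | no ¬ends = _ , step (e , ¬ends) (proj₂ (lift r))

  old-walk : ∀ x y → ∃[ qs ] Walk Eˢ (suc x) (suc y) qs
  old-walk x y = lift (proj₁ (proj₂ (connected x y)))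

  Eˢ-connected : ∀ a b → ∃[ qs ] Path Eˢ a b qs
  Eˢ-connected zero    zero    = _ , here zero , [] ∷ []
  Eˢ-connected zero    (suc y) = walk⇒path Eˢ (step (inj₁ refl) (proj₂ (old-walk v y)))
  Eˢ-connected (suc x) zero    = walk⇒path Eˢ (snoc Eˢ (proj₂ (old-walk x v)) (inj₁ refl))
  Eˢ-connected (suc x) (suc y) = walk⇒path Eˢ (proj₂ (old-walk x y))

  subdivided-tree : IsTree (suc m) Eˢ
  subdivided-tree = record
    { nonempty   = _
    ; symmetric  = Eˢ-sym
    ; loopless   = Eˢ-loopless
    ; connected  = Eˢ-connected
    ; uniquePath = Eˢ-unique
    }

  midpoint-on-path : ∀ {x y qs} → Path Eˢ (suc x) (suc y) qs → zero ∈ qs → v ∈ trace qs × w ∈ trace qs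
  midpoint-on-path (step {v = suc z} _ r , _ ∷ u) (there mid∈) =
    ×-map there there (midpoint-on-path (r , u) mid∈)
  midpoint-on-path {x} (step {v = zero} x-end (step {v = suc z} {vs = vs} z-end r) , u) _ =
    both-ends {P = _∈ x ∷ trace vs} (detour-ends x-end z-end r u)
      (here refl) (there (∈-trace⁺ (start∈ Eˢ r)))

  OnPathTo : Fin m → Fin m → Fin m → Set
  OnPathTo y u a = ∃[ ps ] (Path E a y ps × u ∈ ps)

  paths-from-midpoint : ∀ {y u qs} → Path Eˢ zero (suc y) qs → suc u ∈ qs → OnPathTo y u v × OnPathTo y u w
  paths-from-midpoint {y} (step {v = suc z} {vs = vs} z-end r , uq@(_ ∷ uq′)) (there u∈) with partner z-end
  ... | z̄ , ends = both-ends ends (_ , p , ∈-trace⁺ u∈) (_ , p̄ , there (∈-trace⁺ u∈))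
    where
    p : Path E z y (trace vs)
    p = trace-path (r , uq′)
    z̄∉ : z̄ ∉ trace vs
    z̄∉ = avoids-partner ends (r , uq′) (Unique[x∷xs]⇒x∉xs uq) ∘ ∈-trace⁻
    p̄ : Path E z̄ y (z̄ ∷ trace vs)
    p̄ = step (ends-edge (ends-sym ends)) (proj₁ p) , unique-∷ z̄∉ (proj₂ p)
between-left : ∀ {n} {Q S : BRel n} → IsStrictLinearOrder Q → Q ∈[ Q , S ]
between-left L = L , λ _ _ Q-xy _ → Q-xy

between-sym : ∀ {n} {Q R S : BRel n} → Q ∈[ R , S ] → Q ∈[ S , R ]
between-sym (L , R∩S⊆Q) = L , λ x y S-xy R-xy → R∩S⊆Q x y R-xy S-xy

module Labelling {n} {𝒟 : Domain n} {m} {E : Fin m → Fin m → Set} (T : IsTree m E)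
  {f : Fin m → BRel n} (f-inj : Injective _≡_ _≡_ f) (f-onto : ∀ R → 𝒟 R ⇔ (∃[ v ] f v ≡ R))
  (f-sc : ∀ v v' u vs → Path E v v' vs → u ∈ vs → f u ∈[ f v , f v' ]) where
  open IsTree T

  labelled : ∀ v → 𝒟 (f v)
  labelled v = Equivalence.from (f-onto (f v)) (v , refl)

  -- Γ-adjacent orders label adjacent vertices: an interior vertex z of the
  -- path from v to w would carry an order of 𝒟 between f v and f w.
  Γ-edge⇒tree-edge : ∀ {v w} → ΓAdj 𝒟 (f v) (f w) → E v w
  Γ-edge⇒tree-edge {v} {w} (_ , _ , fv≢fw , only-ends) with connected v w
  ... | _ , here _ , _ = contradiction refl fv≢fw
  ... | _ , step {v = z} v—z r , u
    with only-ends (f z) (labelled z) (f-sc v w z _ (step v—z r , u) (there (Walks.start∈ E r)))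
  ...   | inj₁ fz≡fv = contradiction (subst (_∈ _) (f-inj fz≡fv) (Walks.start∈ E r)) (Unique[x∷xs]⇒x∉xs u)
  ...   | inj₂ fz≡fw = subst (E v) (f-inj fz≡fw) v—z

  adjacent-split : ∀ {v w} → E v w → ∀ t → f w ∈[ f t , f v ] ⊎ f v ∈[ f t , f w ]
  adjacent-split {v} {w} v—w t with connected t v
  ... | ps , p with any? (w ≟_) ps
  ...   | yes w∈ps = inj₁ (f-sc t v w ps p w∈ps)
  ...   | no w∉ps = inj₂ (f-sc t w v _ (Walks.extend-path E p v—w w∉ps) (∈-++⁺ˡ (Walks.end∈ E (proj₁ p))))

module Insertion {n} {𝒟 : Domain n} (dom : IsDomain 𝒟) {m} {E : Fin m → Fin m → Set} (T : IsTree m E)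
  {f : Fin m → BRel n} (f-inj : Injective _≡_ _≡_ f) (f-onto : ∀ R → 𝒟 R ⇔ (∃[ v ] f v ≡ R))
  (f-sc : ∀ v v' u vs → Path E v v' vs → u ∈ vs → f u ∈[ f v , f v' ])
  {v w : Fin m} (v—w : E v w) {Q : BRel n} (Q-linear : IsStrictLinearOrder Q)
  (Q-⊇ : ∀ x y → f v ∶ x ≻ y → f w ∶ x ≻ y → Q ∶ x ≻ y)
  (Q-⊆ : ∀ x y → Q ∶ x ≻ y → f v ∶ x ≻ y ⊎ f w ∶ x ≻ y)
  (Q∉𝒟 : ¬ 𝒟 Q) where
  open Subdivision T v—w
  open Labelling T f-inj f-onto f-sc using (labelled)

  𝒟∪Q : Domain n
  𝒟∪Q S = 𝒟 S ⊎ S ≡ Q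

  label : Fin (suc m) → BRel n
  label zero    = Q
  label (suc x) = f x

  label-inj : Injective _≡_ _≡_ label
  label-inj {zero}  {zero}  _     = refl
  label-inj {zero}  {suc y} Q≡fy = contradiction (subst 𝒟 (sym Q≡fy) (labelled y)) Q∉𝒟
  label-inj {suc x} {zero}  fx≡Q = contradiction (subst 𝒟 fx≡Q (labelled x)) Q∉𝒟
  label-inj {suc x} {suc y} eq   = cong suc (f-inj eq)

  label-onto : ∀ S → 𝒟∪Q S ⇔ (∃[ t ] label t ≡ S)
  label-onto S = mk⇔ to from
    where
    to : 𝒟∪Q S → ∃[ t ] label t ≡ S
    to (inj₁ S∈𝒟) = let (x , fx≡S) = Equivalence.to (f-onto S) S∈𝒟 in suc x , fx≡S
    to (inj₂ refl) = zero , refl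
    from : ∃[ t ] label t ≡ S → 𝒟∪Q S
    from (zero  , refl) = inj₂ refl
    from (suc x , refl) = inj₁ (labelled x)

  -- on a path from the midpoint to y, a vertex u sees Q ∩ f y: each pair of
  -- Q is in f v or in f w, and u lies on the paths from v and from w to y
  from-midpoint : ∀ y t qs → Path Eˢ zero (suc y) qs → t ∈ qs → label t ∈[ Q , f y ]
  from-midpoint y zero    qs p _  = between-left {S = f y} Q-linear
  from-midpoint y (suc u) qs p u∈ with paths-from-midpoint p u∈
  ... | (_ , path-v , u∈path-v) , (_ , path-w , u∈path-w) = dom (f u) (labelled u) , Q∩fy⊆fu
    where
    Q∩fy⊆fu : ∀ a b → Q ∶ a ≻ b → f y ∶ a ≻ b → f u ∶ a ≻ b
    Q∩fy⊆fu a b Q-ab fy-ab with Q-⊆ a b Q-ab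
    ... | inj₁ fv-ab = proj₂ (f-sc v y u _ path-v u∈path-v) a b fv-ab fy-ab
    ... | inj₂ fw-ab = proj₂ (f-sc w y u _ path-w u∈path-w) a b fw-ab fy-ab

  -- the midpoint on a path between old vertices x , y: then v and w lie on
  -- the old path, so f x ∩ f y ⊆ f v ∩ f w ⊆ Q
  midpoint-between : ∀ x y qs → Path Eˢ (suc x) (suc y) qs → zero ∈ qs → Q ∈[ f x , f y ]
  midpoint-between x y qs p mid∈ with midpoint-on-path p mid∈
  ... | v∈ , w∈ = Q-linear , λ a b fx-ab fy-ab →
    Q-⊇ a b (proj₂ (f-sc x y v _ (trace-path p) v∈) a b fx-ab fy-ab)
            (proj₂ (f-sc x y w _ (trace-path p) w∈) a b fx-ab fy-ab)

  label-sc : ∀ a b t qs → Path Eˢ a b qs → t ∈ qs → label t ∈[ label a , label b ]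
  label-sc zero zero t qs p t∈ with mid-loop p
  ... | refl with t∈
  ...   | here refl = between-left {S = Q} Q-linear
  label-sc zero    (suc y) t       qs p t∈   = from-midpoint y t qs p t∈
  label-sc (suc x) zero    t       qs p t∈   =
    between-sym {R = Q} {S = f x} (from-midpoint x t _ (Walks.reverse-path Eˢ Eˢ-sym p) (Any.reverse⁺ t∈))
  label-sc (suc x) (suc y) zero    qs p mid∈ = midpoint-between x y qs p mid∈
  label-sc (suc x) (suc y) (suc u) qs p u∈   = f-sc x y u _ (trace-path p) (∈-trace⁺ u∈)

  insertion : GeneralizedSingleCrossing 𝒟∪Q
  insertion = 𝒟∪Q-domain , suc m , Eˢ , subdivided-tree , label , label-inj , label-onto , label-sc
    where
    𝒟∪Q-domain : IsDomain 𝒟∪Q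
    𝒟∪Q-domain S (inj₁ S∈𝒟) = dom S S∈𝒟
    𝒟∪Q-domain S (inj₂ refl) = Q-linear

module Γ-Edge {n} {𝒟 : Domain n} (dom : IsDomain 𝒟) {m} {E : Fin m → Fin m → Set} (T : IsTree m E)
  {f : Fin m → BRel n} (f-inj : Injective _≡_ _≡_ f) (f-onto : ∀ R → 𝒟 R ⇔ (∃[ v ] f v ≡ R))
  (f-sc : ∀ v v' u vs → Path E v v' vs → u ∈ vs → f u ∈[ f v , f v' ])
  {v w : Fin m} (Γ-vw : ΓAdj 𝒟 (f v) (f w)) where
  open Labelling T f-inj f-onto f-sc

  R R' : BRel n
  R  = f v
  R' = f w

  L : IsStrictLinearOrder R
  L = dom R (labelled v)

  L' : IsStrictLinearOrder R'
  L' = dom R' (labelled w)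

  inversion : AdjacentInversion R R'
  inversion = Inversions.adjacent-inversion L L' (proj₁ (proj₂ (proj₂ Γ-vw)))

  open AdjacentInversion inversion
  open AdjacentSwap L top≻bottom nothing-between

  Q-⊇R∩R' : ∀ x y → R ∶ x ≻ y → R' ∶ x ≻ y → Q ∶ x ≻ y
  Q-⊇R∩R' x y R-xy R'-xy = Q-⊇ x y R-xy λ { (refl , refl) → LinearOrder.asym L' inverted R'-xy }

  Q-⊆R∪R' : ∀ x y → Q ∶ x ≻ y → R ∶ x ≻ y ⊎ R' ∶ x ≻ y
  Q-⊆R∪R' x y Q-xy with Q-⊆ x y Q-xy
  ... | inj₁ (refl , refl) = inj₂ inverted
  ... | inj₂ R-xy = inj₁ R-xy

  -- Q = f t for some vertex t.  If w lies between t and v, then R' ⊇ Q ∩ R,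
  -- which with (bottom , top) ∈ R' gives Q ⊆ R'.  If v lies between t and w,
  -- then R ⊇ Q ∩ R' ∋ (bottom , top), contradicting top ≻ bottom in R.
  swap-in-domain : 𝒟 Q → Q ≡ R'
  swap-in-domain Q∈𝒟 with Equivalence.to (f-onto Q) Q∈𝒟
  ... | t , ft≡Q with subst (λ S → R' ∈[ S , R ] ⊎ R ∈[ S , R' ]) ft≡Q
                            (adjacent-split (Γ-edge⇒tree-edge Γ-vw) t)
  ...   | inj₁ R'∈[Q,R] = linear-⊆⇒≡ Q-linear L' Q⊆R'
    where
    Q⊆R' : ∀ x y → Q ∶ x ≻ y → R' ∶ x ≻ y
    Q⊆R' x y Q-xy with Q-⊆ x y Q-xy
    ... | inj₁ (refl , refl) = inverted
    ... | inj₂ R-xy = proj₂ R'∈[Q,R] x y Q-xy R-xy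
  ...   | inj₂ R∈[Q,R'] = contradiction (proj₂ R∈[Q,R'] bottom top Q-b≻a inverted) (LinearOrder.asym L top≻bottom)

  permutohedron-edge : (∀ 𝒟' → GeneralizedSingleCrossing 𝒟' → ¬ (𝒟 ⊆ 𝒟' × ∃[ S ] (𝒟' S × ¬ 𝒟 S))) →
    PermAdj R R'
  permutohedron-edge maximal with ≡-dec (≡-dec Bool._≟_) Q R'
  ... | yes Q≡R' = L , L' , top , bottom , inj₁ (subst (SwapAdjacent R top bottom) Q≡R' swap-adjacent)
  ... | no Q≢R' = ⊥-elim (maximal 𝒟∪Q insertion ((λ _ → inj₁) , Q , inj₂ refl , Q∉𝒟))
    where
    Q∉𝒟 : ¬ 𝒟 Q
    Q∉𝒟 = Q≢R' ∘ swap-in-domain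
    open Insertion dom T f-inj f-onto f-sc (Γ-edge⇒tree-edge Γ-vw) Q-linear Q-⊇R∩R' Q-⊆R∪R' Q∉𝒟

corollary5p1 : (n : ℕ) (𝒟 : Domain n) → MaximalGSC 𝒟 →
  ∀ R R' → ΓAdj 𝒟 R R' → PermAdj R R'
corollary5p1 n 𝒟 ((dom , m , E , T , f , f-inj , f-onto , f-sc) , maximal) R R' Γ-RR'
  with Equivalence.to (f-onto R) (proj₁ Γ-RR') | Equivalence.to (f-onto R') (proj₁ (proj₂ Γ-RR'))
... | v , refl | w , refl = Γ-Edge.permutohedron-edge dom T f-inj f-onto f-sc Γ-RR' maximal
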